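{- For no constant $\varepsilon>0$ does there exist an online algorithm for $1|jrp,s=1,p_j=1,r_j|\sum F_j+c_\mathcal{Q}$ with competitive ratio $\frac32-\varepsilon$ or better.
   Context: Problem $1|jrp,s=1,p_j=1,r_j|\sum F_j+c_\mathcal{Q}$: jobs with processing time $1$ and nonnegative integer release dates $r_j$ must be processed non-preemptively on a single machine (at most one job at a time). There is a single resource, required by every job; each replenishment of it costs $K:=K_0+K_1\ge0$ (part of the instance). A solution consists of start times $S_j$ (completion times $C_j=S_j+1$) and replenishment times $t_1<\dots<t_q$; it is feasible if no two jobs overlap and for each job $j$ some replenishment time lies in $[r_j,S_j]$. Its cost is $\sum_jF_j+qK$, where $F_j=C_j-r_j$. Online setting: jobs are not known in advance (neither their number nor their data); a job becomes known at its release date, and replenishment and scheduling decisions cannot be revoked. An online algorithm has competitive ratio $c$ if on every instance its cost is at most $c$ times the optimal offline cost. -}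

module Defs where

open import Data.Nat as ℕ using (ℕ; zero; suc; _∸_)
open import Data.Bool using (Bool; true; false; if_then_else_)
open import Data.Maybe using (Maybe; just; nothing)
open import Data.List using (List; length; filter; map; upTo)
open import Data.Product using (Σ; _×_; ∃; proj₁; proj₂)
open import Data.Integer using (+_)
open import Data.Rational using (ℚ; _/_; _+_; _*_; _-_; _≤_; _<_; 0ℚ)
open import Relation.Nullary.Decidable using (⌊_⌋)
open import Relation.Binary.PropositionalEquality using (_≡_)

-- A unit job started at integer time s
-- occupies [s, s+1).  An instance is a finite list of release dates
-- (one entry per job) together with the replenishment cost K ≥ 0.

released : List ℕ → ℕ → ℕ
released jobs r = length (filter (ℕ._≟ r) jobs)

-- A schedule: at each integer time s, either no job starts, or one job with
-- release date r starts (jobs with equal release date are interchangeable);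
-- and whether a replenishment happens at time s.
record Schedule : Set where
  field
    start : ℕ → Maybe ℕ
    repl  : ℕ → Bool
open Schedule public

startsWith : ℕ → Maybe ℕ → ℕ
startsWith r nothing   = 0
startsWith r (just r') = if ⌊ r ℕ.≟ r' ⌋ then 1 else 0

countStarts : Schedule → ℕ → ℕ → ℕ
countStarts σ r zero    = 0
countStarts σ r (suc T) = countStarts σ r T ℕ.+ startsWith r (start σ T)

-- flow time F = C - r = (s + 1) - r of a job started at s
flowAt : ℕ → Maybe ℕ → ℕ
flowAt s nothing  = 0
flowAt s (just r) = suc s ∸ r

flowSum : Schedule → ℕ → ℕ
flowSum σ zero    = 0
flowSum σ (suc T) = flowSum σ T ℕ.+ flowAt T (start σ T)

replCount : Schedule → ℕ → ℕ
replCount σ zero    = 0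
replCount σ (suc T) = replCount σ T ℕ.+ (if repl σ T then 1 else 0)

toℚ : ℕ → ℚ
toℚ n = + n / 1

cost : ℚ → Schedule → ℕ → ℚ
cost K σ T = toℚ (flowSum σ T) + K * toℚ (replCount σ T)

Feasible : List ℕ → Schedule → ℕ → Set
Feasible jobs σ T =
    (∀ s → T ℕ.≤ s → (start σ s ≡ nothing) × (repl σ s ≡ false))
  × (∀ s r → start σ s ≡ just r →
        (r ℕ.≤ s) × ∃ λ t → (r ℕ.≤ t) × (t ℕ.≤ s) × (repl σ t ≡ true))
  × (∀ r → countStarts σ r T ≡ released jobs r)

Decision : Set
Decision = Bool × Maybe ℕ

-- An (deterministic) online algorithm: given K and the history of arrivals
-- up to and including the current time t (the list [n_0, …, n_t] where n_i is
-- the number of jobs released at time i), it decides what to do at time t.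
-- Its own past decisions are determined by the earlier history.
OnlineAlgorithm : Set
OnlineAlgorithm = ℚ → List ℕ → Decision

history : List ℕ → ℕ → List ℕ
history jobs t = map (released jobs) (upTo (suc t))

run : OnlineAlgorithm → ℚ → List ℕ → Schedule
run A K jobs = record
  { start = λ t → proj₂ (A K (history jobs t))
  ; repl  = λ t → proj₁ (A K (history jobs t)) }

Competitive : ℚ → OnlineAlgorithm → Set
Competitive c A =
  ∀ (K : ℚ) → 0ℚ ≤ K → (jobs : List ℕ) →
  Σ ℕ λ T → Feasible jobs (run A K jobs) T ×
    (∀ (σ : Schedule) (T' : ℕ) → Feasible jobs σ T' →
       cost K (run A K jobs) T ≤ c * cost K σ T')

threeHalves : ℚ
threeHalves = + 3 / 2

module Submission where

-- The adversary releases one job at time 0 and sets K = 2m, where m = D + 8 and D is the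
-- denominator of ε, so that ε ≥ 1/D.  If the algorithm has not replenished before m, that
-- job alone costs it at least (m + 1) + K, against 1 + K for serving it at once.  Otherwise,
-- at its first replenishment t < m, a second job is released at t + 1: it needs a second
-- replenishment, so the algorithm pays at least (t + 2) + 2K, while waiting until t + 1 and
-- serving both jobs costs (t + 4) + K.  An online algorithm cannot tell the two instances
-- apart before t + 1, and in both cases the cost ratio exceeds 3/2 − 1/D.

open import Defs
open import Data.Bool using (Bool; true; false; if_then_else_)
open import Data.Empty using (⊥; ⊥-elim)
open import Data.List using (List; []; _∷_; length)
open import Data.Maybe using (just; nothing)
open import Data.Product using (Σ; _×_; _,_; proj₁; proj₂; ∃)
open import Data.Sum using (_⊎_; inj₁; inj₂; [_,_]′)
open import Function using (_∘_; case_of_)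
open import Relation.Binary.PropositionalEquality

module ℕ↪ℚ where

  open import Data.Nat using (_+_; _*_; _≤_; suc; z≤n; s≤s)
  import Data.Nat.Properties as ℕ
  open import Data.Rational as ℚ using (mkℚ; toℚᵘ)
  import Data.Rational.Properties as ℚ
  open import Data.Integer as ℤ using (+_; +[1+_])
  import Data.Integer.Properties as ℤ
  import Data.Integer.Tactic.RingSolver as ℤ-Solver
  open import Data.Nat.Coprimality using (gcd≡1⇒coprime)
  open import Data.Nat.GCD using (gcd-zeroʳ)
  open import Data.Rational.Unnormalised as ℚᵘ using (mkℚᵘ; *≡*)
  import Data.Rational.Unnormalised.Properties as ℚᵘ

  toℚᵘ-toℚ : ∀ n → toℚᵘ (toℚ n) ≡ mkℚᵘ (+ n) 0
  toℚᵘ-toℚ n = cong toℚᵘ (ℚ.normalize-coprime (gcd≡1⇒coprime (gcd-zeroʳ n)))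

  toℚ-+ : ∀ m n → toℚ (m + n) ≡ toℚ m ℚ.+ toℚ n
  toℚ-+ m n = ℚ.toℚᵘ-injective (begin
    toℚᵘ (toℚ (m + n))                 ≡⟨ toℚᵘ-toℚ (m + n) ⟩
    mkℚᵘ (+ (m + n)) 0                 ≈⟨ *≡* (cong (ℤ._* + 1) (trans (ℤ.pos-+ m n)
                                            (sym (cong₂ ℤ._+_ (ℤ.*-identityʳ (+ m)) (ℤ.*-identityʳ (+ n)))))) ⟩
    mkℚᵘ (+ m) 0 ℚᵘ.+ mkℚᵘ (+ n) 0     ≡⟨ sym (cong₂ ℚᵘ._+_ (toℚᵘ-toℚ m) (toℚᵘ-toℚ n)) ⟩
    toℚᵘ (toℚ m) ℚᵘ.+ toℚᵘ (toℚ n)     ≈⟨ ℚᵘ.≃-sym (ℚ.toℚᵘ-homo-+ (toℚ m) (toℚ n)) ⟩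
    toℚᵘ (toℚ m ℚ.+ toℚ n)             ∎)
    where open ℚᵘ.≃-Reasoning

  toℚ-* : ∀ m n → toℚ (m * n) ≡ toℚ m ℚ.* toℚ n
  toℚ-* m n = ℚ.toℚᵘ-injective (begin
    toℚᵘ (toℚ (m * n))                 ≡⟨ toℚᵘ-toℚ (m * n) ⟩
    mkℚᵘ (+ (m * n)) 0                 ≈⟨ *≡* (cong (ℤ._* + 1) (ℤ.pos-* m n)) ⟩
    mkℚᵘ (+ m) 0 ℚᵘ.* mkℚᵘ (+ n) 0     ≡⟨ sym (cong₂ ℚᵘ._*_ (toℚᵘ-toℚ m) (toℚᵘ-toℚ n)) ⟩
    toℚᵘ (toℚ m) ℚᵘ.* toℚᵘ (toℚ n)     ≈⟨ ℚᵘ.≃-sym (ℚ.toℚᵘ-homo-* (toℚ m) (toℚ n)) ⟩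
    toℚᵘ (toℚ m ℚ.* toℚ n)             ∎)
    where open ℚᵘ.≃-Reasoning

  toℚ-mono-≤ : ∀ {m n} → m ≤ n → toℚ m ℚ.≤ toℚ n
  toℚ-mono-≤ {m} {n} m≤n = ℚ.toℚᵘ-cancel-≤
    (subst₂ ℚᵘ._≤_ (sym (toℚᵘ-toℚ m)) (sym (toℚᵘ-toℚ n)) (ℚᵘ.*≤* (ℤ.*-monoʳ-≤-nonNeg (+ 1) (ℤ.+≤+ m≤n))))

  cost-toℚ : ∀ k σ T → cost (toℚ k) σ T ≡ toℚ (flowSum σ T + k * replCount σ T)
  cost-toℚ k σ T = sym (trans (toℚ-+ (flowSum σ T) _) (cong (toℚ (flowSum σ T) ℚ.+_) (toℚ-* k (replCount σ T))))

  private
    pos-*-* : ∀ a b c → + (a * b * c) ≡ + a ℤ.* + b ℤ.* + c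
    pos-*-* a b c = trans (ℤ.pos-* (a * b) c) (cong (ℤ._* + c) (ℤ.pos-* a b))

  -- The hypothesis is A ≤ (3/2 − E/D) · B cross-multiplied, in the form ℚᵘ.drop-*≤* produces.
  cross-multiplied-bound : ∀ A B D E →
    + A ℤ.* + (2 * D * 1) ℤ.≤ ((+ 3 ℤ.* + D ℤ.+ ℤ.- + E ℤ.* + 2) ℤ.* + B) ℤ.* + 1 →
    2 * D * A + 2 * E * B ≤ 3 * D * B
  cross-multiplied-bound A B D E h = ℤ.drop‿+≤+ (begin
    + (2 * D * A + 2 * E * B)                         ≡⟨ ℤ.pos-+ (2 * D * A) (2 * E * B) ⟩
    + (2 * D * A) ℤ.+ + (2 * E * B)                   ≡⟨ cong₂ ℤ._+_ (pos-*-* 2 D A) (pos-*-* 2 E B) ⟩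
    + 2 ℤ.* + D ℤ.* + A ℤ.+ + 2 ℤ.* + E ℤ.* + B        ≡⟨ cong (ℤ._+ + 2 ℤ.* + E ℤ.* + B)
                                                           (trans (swap (+ A) (+ D)) (cong (+ A ℤ.*_) (sym (pos-*-* 2 D 1)))) ⟩
    + A ℤ.* + (2 * D * 1) ℤ.+ + 2 ℤ.* + E ℤ.* + B      ≤⟨ ℤ.+-monoˡ-≤ (+ 2 ℤ.* + E ℤ.* + B) h ⟩
    ((+ 3 ℤ.* + D ℤ.+ ℤ.- + E ℤ.* + 2) ℤ.* + B) ℤ.* + 1 ℤ.+ + 2 ℤ.* + E ℤ.* + B
                                                      ≡⟨ cancel (+ D) (+ E) (+ B) ⟩
    + 3 ℤ.* + D ℤ.* + B                                ≡⟨ pos-*-* 3 D B ⟨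
    + (3 * D * B)                                     ∎)
    where
    open ℤ.≤-Reasoning
    swap : ∀ a d → + 2 ℤ.* d ℤ.* a ≡ a ℤ.* (+ 2 ℤ.* d ℤ.* + 1)
    swap = ℤ-Solver.solve-∀
    cancel : ∀ d e b → ((+ 3 ℤ.* d ℤ.+ ℤ.- e ℤ.* + 2) ℤ.* b) ℤ.* + 1 ℤ.+ + 2 ℤ.* e ℤ.* b ≡ + 3 ℤ.* d ℤ.* b
    cancel = ℤ-Solver.solve-∀

  below-threeHalves-ε : ∀ ε → ℚ.Positive ε → ∀ A B → toℚ A ℚ.≤ (threeHalves ℚ.- ε) ℚ.* toℚ B →
                        2 * ℚ.↧ₙ ε * A + 2 * B ≤ 3 * ℚ.↧ₙ ε * B
  below-threeHalves-ε ε@(mkℚ +[1+ e ] d _) _ A B h =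
    ℕ.≤-trans (ℕ.+-monoʳ-≤ (2 * suc d * A) (ℕ.*-monoˡ-≤ B (ℕ.*-monoʳ-≤ 2 {1} {suc e} (s≤s z≤n))))
              (cross-multiplied-bound A B (suc d) (suc e) (ℚᵘ.drop-*≤* hᵘ))
    where
    open ℚᵘ.≃-Reasoning
    B≃ : toℚᵘ ((threeHalves ℚ.- ε) ℚ.* toℚ B) ℚᵘ.≃ (toℚᵘ threeHalves ℚᵘ.- toℚᵘ ε) ℚᵘ.* mkℚᵘ (+ B) 0
    B≃ = begin
      toℚᵘ ((threeHalves ℚ.- ε) ℚ.* toℚ B)                   ≈⟨ ℚ.toℚᵘ-homo-* (threeHalves ℚ.- ε) (toℚ B) ⟩
      toℚᵘ (threeHalves ℚ.- ε) ℚᵘ.* toℚᵘ (toℚ B)              ≈⟨ ℚᵘ.*-congʳ {toℚᵘ (toℚ B)}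
                                                                 (ℚ.toℚᵘ-homo-+ threeHalves (ℚ.- ε)) ⟩
      (toℚᵘ threeHalves ℚᵘ.+ toℚᵘ (ℚ.- ε)) ℚᵘ.* toℚᵘ (toℚ B)  ≈⟨ ℚᵘ.*-congʳ {toℚᵘ (toℚ B)}
                                                                 (ℚᵘ.+-congʳ (toℚᵘ threeHalves) (ℚ.toℚᵘ-homo‿- ε)) ⟩
      (toℚᵘ threeHalves ℚᵘ.- toℚᵘ ε) ℚᵘ.* toℚᵘ (toℚ B)        ≡⟨ cong ((toℚᵘ threeHalves ℚᵘ.- toℚᵘ ε) ℚᵘ.*_) (toℚᵘ-toℚ B) ⟩
      (toℚᵘ threeHalves ℚᵘ.- toℚᵘ ε) ℚᵘ.* mkℚᵘ (+ B) 0       ∎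
    hᵘ : mkℚᵘ (+ A) 0 ℚᵘ.≤ (toℚᵘ threeHalves ℚᵘ.- toℚᵘ ε) ℚᵘ.* mkℚᵘ (+ B) 0
    hᵘ = ℚᵘ.≤-respʳ-≃ B≃ (subst (ℚᵘ._≤ _) (toℚᵘ-toℚ A) (ℚ.toℚᵘ-mono-≤ h))

module Schedules where

  open import Data.List.Properties using (map-cong-local; filter-accept; filter-reject)
  import Data.List.Relation.Unary.All as All
  open import Data.List.Relation.Unary.All.Properties using (all-upTo)
  open import Data.Maybe.Properties using (just-injective)
  open import Data.Nat as ℕ using (ℕ; zero; suc; _+_; _∸_; _≤_; _<_; z≤n; s≤s)
  import Data.Nat.Properties as ℕ
  open import Relation.Binary.Definitions using (tri<; tri≈; tri>)
  open import Relation.Nullary using (yes; no)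

  sumBelow : (ℕ → ℕ) → ℕ → ℕ
  sumBelow g zero    = 0
  sumBelow g (suc n) = sumBelow g n + g n

  term≤sumBelow : ∀ g {i} n → i < n → g i ≤ sumBelow g n
  term≤sumBelow g (suc n) i<1+n with ℕ.m<1+n⇒m<n∨m≡n i<1+n
  ... | inj₁ i<n  = ℕ.≤-trans (term≤sumBelow g n i<n) (ℕ.m≤m+n _ _)
  ... | inj₂ refl = ℕ.m≤n+m _ _

  ordered-terms≤sumBelow : ∀ g {i j} n → i < j → j < n → g i + g j ≤ sumBelow g n
  ordered-terms≤sumBelow g (suc n) i<j j<1+n with ℕ.m<1+n⇒m<n∨m≡n j<1+n
  ... | inj₁ j<n  = ℕ.≤-trans (ordered-terms≤sumBelow g n i<j j<n) (ℕ.m≤m+n _ _)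
  ... | inj₂ refl = ℕ.+-monoˡ-≤ _ (term≤sumBelow g n i<j)

  terms≤sumBelow : ∀ g {i j} n → i ≢ j → i < n → j < n → g i + g j ≤ sumBelow g n
  terms≤sumBelow g {i} {j} n i≢j i<n j<n with ℕ.<-cmp i j
  ... | tri< i<j _ _ = ordered-terms≤sumBelow g n i<j j<n
  ... | tri≈ _ i≡j _ = ⊥-elim (i≢j i≡j)
  ... | tri> _ _ j<i = subst (_≤ sumBelow g n) (ℕ.+-comm (g j) (g i)) (ordered-terms≤sumBelow g n j<i i<n)

  sumBelow-pos : ∀ g n → 0 < sumBelow g n → ∃ λ i → i < n × 0 < g i
  sumBelow-pos g (suc n) 0<sum with g n in gn≡
  ... | suc _ = n , ℕ.≤-refl , subst (0 <_) (sym gn≡) (s≤s z≤n)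
  ... | zero with sumBelow-pos g n (subst (0 <_) (ℕ.+-identityʳ _) 0<sum)
  ...   | i , i<n , 0<gi = i , ℕ.m≤n⇒m≤1+n i<n , 0<gi

  sumBelow-zero : ∀ g n → (∀ i → i < n → g i ≡ 0) → sumBelow g n ≡ 0
  sumBelow-zero g zero    _    = refl
  sumBelow-zero g (suc n) g≡0 = cong₂ _+_ (sumBelow-zero g n (λ i i<n → g≡0 i (ℕ.m≤n⇒m≤1+n i<n))) (g≡0 n ℕ.≤-refl)

  flowSum≡sumBelow : ∀ σ T → flowSum σ T ≡ sumBelow (λ s → flowAt s (start σ s)) T
  flowSum≡sumBelow σ zero    = refl
  flowSum≡sumBelow σ (suc T) = cong (_+ flowAt T (start σ T)) (flowSum≡sumBelow σ T)

  replCount≡sumBelow : ∀ σ T → replCount σ T ≡ sumBelow (λ s → if repl σ s then 1 else 0) T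
  replCount≡sumBelow σ zero    = refl
  replCount≡sumBelow σ (suc T) = cong (_+ (if repl σ T then 1 else 0)) (replCount≡sumBelow σ T)

  countStarts≡sumBelow : ∀ σ r T → countStarts σ r T ≡ sumBelow (λ s → startsWith r (start σ s)) T
  countStarts≡sumBelow σ r zero    = refl
  countStarts≡sumBelow σ r (suc T) = cong (_+ startsWith r (start σ T)) (countStarts≡sumBelow σ r T)

  startsWith-self : ∀ r → startsWith r (just r) ≡ 1
  startsWith-self r with r ℕ.≟ r
  ... | yes _   = refl
  ... | no r≢r = ⊥-elim (r≢r refl)

  startsWith-≢ : ∀ {r x} → r ≢ x → startsWith r (just x) ≡ 0
  startsWith-≢ {r} {x} r≢x with r ℕ.≟ x
  ... | yes r≡x = ⊥-elim (r≢x r≡x)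
  ... | no _    = refl

  startsWith-pos : ∀ r x → 0 < startsWith r x → x ≡ just r
  startsWith-pos r (just x) 0<sw with r ℕ.≟ x
  ... | yes refl = refl

  released-∷ : ∀ x xs r → released (x ∷ xs) r ≡ startsWith r (just x) + released xs r
  released-∷ x xs r with r ℕ.≟ x
  ... | yes refl = cong length (filter-accept (ℕ._≟ r) refl)
  ... | no r≢x   = cong length (filter-reject (ℕ._≟ r) (r≢x ∘ sym))

  released-head : ∀ x xs → 0 < released (x ∷ xs) x
  released-head x xs = subst (0 <_) (sym (released-∷ x xs x))
    (subst (λ n → 0 < n + released xs x) (sym (startsWith-self x)) (s≤s z≤n))

  record Service (σ : Schedule) (T r : ℕ) : Set where
    field
      startTime          : ℕ
      starts             : start σ startTime ≡ just r
      startTime<T        : startTime < T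
      replTime           : ℕ
      r≤replTime         : r ≤ replTime
      replTime≤startTime : replTime ≤ startTime
      replenishes        : repl σ replTime ≡ true

    replTime<T : replTime < T
    replTime<T = ℕ.≤-<-trans replTime≤startTime startTime<T

    flowTime : ℕ
    flowTime = suc startTime ∸ r

  open Service public

  served : ∀ {jobs σ T r} → Feasible jobs σ T → 0 < released jobs r → Service σ T r
  served {jobs} {σ} {T} {r} (_ , ready , counts) r-released
    with s , s<T , 0<sw ← sumBelow-pos _ T (subst (0 <_) (trans (sym (counts r)) (countStarts≡sumBelow σ r T)) r-released)
    with starts-r ← startsWith-pos r (start σ s) 0<sw
    with _ , u , r≤u , u≤s , repl-u ← ready s r starts-r
    = record { startTime = s ; starts = starts-r ; startTime<T = s<T
             ; replTime = u ; r≤replTime = r≤u ; replTime≤startTime = u≤s ; replenishes = repl-u }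

  flowTime≤flowSum : ∀ {σ T r} (job : Service σ T r) → flowTime job ≤ flowSum σ T
  flowTime≤flowSum {σ} {T} job = subst₂ _≤_ (cong (flowAt (startTime job)) (starts job)) (sym (flowSum≡sumBelow σ T))
    (term≤sumBelow (λ s → flowAt s (start σ s)) T (startTime<T job))

  flowTimes≤flowSum : ∀ {σ T r r′} → r ≢ r′ → (job : Service σ T r) (job′ : Service σ T r′) →
                      flowTime job + flowTime job′ ≤ flowSum σ T
  flowTimes≤flowSum {σ} {T} r≢r′ job job′ =
    subst₂ _≤_ (cong₂ _+_ (cong (flowAt (startTime job)) (starts job)) (cong (flowAt (startTime job′)) (starts job′)))
               (sym (flowSum≡sumBelow σ T))
      (terms≤sumBelow (λ s → flowAt s (start σ s)) T same-time⇒same-job (startTime<T job) (startTime<T job′))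
    where
    same-time⇒same-job : startTime job ≢ startTime job′
    same-time⇒same-job eq = r≢r′ (just-injective (trans (sym (starts job)) (trans (cong (start σ) eq) (starts job′))))

  replenishment≤replCount : ∀ {σ T u} → u < T → repl σ u ≡ true → 1 ≤ replCount σ T
  replenishment≤replCount {σ} {T} u<T repl-u =
    subst₂ _≤_ (cong (if_then 1 else 0) repl-u) (sym (replCount≡sumBelow σ T))
      (term≤sumBelow (λ s → if repl σ s then 1 else 0) T u<T)

  replenishments≤replCount : ∀ {σ T u v} → u < v → v < T → repl σ u ≡ true → repl σ v ≡ true → 2 ≤ replCount σ T
  replenishments≤replCount {σ} {T} u<v v<T repl-u repl-v =
    subst₂ _≤_ (cong₂ _+_ (cong (if_then 1 else 0) repl-u) (cong (if_then 1 else 0) repl-v))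
               (sym (replCount≡sumBelow σ T))
      (ordered-terms≤sumBelow (λ s → if repl σ s then 1 else 0) T u<v v<T)

  all-false⊎first-true : (f : ℕ → Bool) (m : ℕ) →
    (∀ i → i < m → f i ≡ false) ⊎ ∃ λ t → t < m × f t ≡ true × (∀ i → i < t → f i ≡ false)
  all-false⊎first-true f zero = inj₁ λ _ ()
  all-false⊎first-true f (suc m) with all-false⊎first-true f m
  ... | inj₂ (t , t<m , ft , before) = inj₂ (t , ℕ.m≤n⇒m≤1+n t<m , ft , before)
  ... | inj₁ below-m with f m in fm
  ...   | true  = inj₂ (m , ℕ.≤-refl , fm , below-m)
  ...   | false = inj₁ λ i i<1+m → [ below-m i , (λ { refl → fm }) ]′ (ℕ.m<1+n⇒m<n∨m≡n i<1+m)

  repl-causal : ∀ A K {jobs jobs′ t} → (∀ i → i ≤ t → released jobs i ≡ released jobs′ i) →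
                ∀ {s} → s ≤ t → repl (run A K jobs) s ≡ repl (run A K jobs′) s
  repl-causal A K same s≤t = cong (λ h → proj₁ (A K h))
    (map-cong-local (All.map (λ i<1+s → same _ (ℕ.≤-trans (ℕ.m<1+n⇒m≤n i<1+s) s≤t)) (all-upTo (suc _))))


module Adversary where

  open import Data.Nat as ℕ using (ℕ; zero; suc; _+_; _*_; _∸_; _≤_; _<_; z≤n; s≤s)
  import Data.Nat.Properties as ℕ
  open import Data.Nat.Tactic.RingSolver using (solve-∀)
  import Data.Rational as ℚ
  import Data.Rational.Properties as ℚ
  import Data.Sum
  open Schedules
  open ℕ↪ℚ using (toℚ-mono-≤; cost-toℚ; below-threeHalves-ε)

  oneJob : List ℕ
  oneJob = 0 ∷ []

  twoJobs : ℕ → List ℕ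
  twoJobs t = 0 ∷ suc t ∷ []

  oneJob≈twoJobs : ∀ {t} i → i ≤ t → released oneJob i ≡ released (twoJobs t) i
  oneJob≈twoJobs {t} i i≤t = begin
    released oneJob i                                        ≡⟨ released-∷ 0 [] i ⟩
    startsWith i (just 0) + 0                                ≡⟨ cong (λ n → startsWith i (just 0) + n) second-not-released ⟨
    startsWith i (just 0) + released (suc t ∷ []) i          ≡⟨ released-∷ 0 (suc t ∷ []) i ⟨
    released (twoJobs t) i                                   ∎
    where
    open ≡-Reasoning
    second-not-released : released (suc t ∷ []) i ≡ 0
    second-not-released = trans (released-∷ (suc t) [] i)
      (cong (_+ 0) (startsWith-≢ λ { refl → ℕ.<-irrefl refl (s≤s i≤t) }))

  serveAtOnce : Schedule
  serveAtOnce = record { start = λ { zero → just 0 ; (suc _) → nothing }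
                       ; repl  = λ { zero → true   ; (suc _) → false } }

  serveAtOnce-feasible : Feasible oneJob serveAtOnce 1
  serveAtOnce-feasible = idle-after , ready , counts
    where
    idle-after : ∀ s → 1 ≤ s → (start serveAtOnce s ≡ nothing) × (repl serveAtOnce s ≡ false)
    idle-after (suc s) _ = refl , refl
    ready : ∀ s r → start serveAtOnce s ≡ just r →
            (r ≤ s) × ∃ λ u → (r ≤ u) × (u ≤ s) × (repl serveAtOnce u ≡ true)
    ready zero .0 refl = z≤n , 0 , z≤n , z≤n , refl
    counts : ∀ r → countStarts serveAtOnce r 1 ≡ released oneJob r
    counts r = trans (sym (ℕ.+-identityʳ _)) (sym (released-∷ 0 [] r))

  -- Indexed by the offset s ∸ t: idle up to time t, then replenish and serve job 0 at
  -- time t + 1 and the second job at time t + 2.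
  waitForSecondAt : ℕ → ℕ → Decision
  waitForSecondAt t 1 = true  , just 0
  waitForSecondAt t 2 = false , just (suc t)
  waitForSecondAt t _ = false , nothing

  waitForSecond : ℕ → Schedule
  waitForSecond t = record { start = λ s → proj₂ (waitForSecondAt t (s ∸ t))
                           ; repl  = λ s → proj₁ (waitForSecondAt t (s ∸ t)) }

  module _ (t : ℕ) where

    private
      σ = waitForSecond t

    waitForSecondAt-idle : ∀ k → k ≡ 0 ⊎ 3 ≤ k → waitForSecondAt t k ≡ (false , nothing)
    waitForSecondAt-idle _ (inj₁ refl)                  = refl
    waitForSecondAt-idle _ (inj₂ (s≤s (s≤s (s≤s _)))) = refl

    waitForSecond-idle : ∀ s → s ≤ t ⊎ 3 + t ≤ s → (start σ s ≡ nothing) × (repl σ s ≡ false)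
    waitForSecond-idle s outside = cong proj₂ idle , cong proj₁ idle
      where
      idle = waitForSecondAt-idle (s ∸ t) (Data.Sum.map ℕ.m≤n⇒m∸n≡0 (ℕ.m+n≤o⇒m≤o∸n 3) outside)

    waitForSecond-first : waitForSecondAt t (suc t ∸ t) ≡ (true , just 0)
    waitForSecond-first = cong (waitForSecondAt t) (ℕ.m+n∸n≡m 1 t)

    waitForSecond-second : waitForSecondAt t (2 + t ∸ t) ≡ (false , just (suc t))
    waitForSecond-second = cong (waitForSecondAt t) (ℕ.m+n∸n≡m 2 t)

    private
      idle-before : ∀ s → s < suc t → start σ s ≡ nothing × repl σ s ≡ false
      idle-before s s<1+t = waitForSecond-idle s (inj₁ (ℕ.m<1+n⇒m≤n s<1+t))

      flowSum-idle : flowSum σ (suc t) ≡ 0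
      flowSum-idle = trans (flowSum≡sumBelow σ (suc t))
        (sumBelow-zero _ (suc t) λ s s<1+t → cong (flowAt s) (proj₁ (idle-before s s<1+t)))

      replCount-idle : replCount σ (suc t) ≡ 0
      replCount-idle = trans (replCount≡sumBelow σ (suc t))
        (sumBelow-zero _ (suc t) λ s s<1+t → cong (if_then 1 else 0) (proj₂ (idle-before s s<1+t)))

      countStarts-idle : ∀ r → countStarts σ r (suc t) ≡ 0
      countStarts-idle r = trans (countStarts≡sumBelow σ r (suc t))
        (sumBelow-zero _ (suc t) λ s s<1+t → cong (startsWith r) (proj₁ (idle-before s s<1+t)))

    waitForSecond-flowSum : flowSum σ (3 + t) ≡ 4 + t
    waitForSecond-flowSum rewrite flowSum-idle | waitForSecond-first | waitForSecond-second =
      trans (cong (2 + t +_) (ℕ.m+n∸n≡m 2 t)) (ℕ.+-comm (2 + t) 2)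

    waitForSecond-replCount : replCount σ (3 + t) ≡ 1
    waitForSecond-replCount rewrite replCount-idle | waitForSecond-first | waitForSecond-second = refl

    waitForSecond-feasible : Feasible (twoJobs t) σ (3 + t)
    waitForSecond-feasible = (λ s 3+t≤s → waitForSecond-idle s (inj₂ 3+t≤s)) , ready , counts
      where
      after-idle : ∀ {s k} → s ∸ t ≡ suc k → t < s
      after-idle off = ℕ.m∸n≢0⇒n<m (λ off≡0 → ℕ.1+n≢0 (trans (sym off) off≡0))
      repl-first : repl σ (suc t) ≡ true
      repl-first = cong proj₁ waitForSecond-first
      ready : ∀ s r → start σ s ≡ just r → (r ≤ s) × ∃ λ u → (r ≤ u) × (u ≤ s) × (repl σ u ≡ true)
      ready s r starts with s ∸ t in off
      ready s .0       refl | 1 = z≤n , suc t , z≤n , after-idle off , repl-first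
      ready s .(suc t) refl | 2 = after-idle off , suc t , ℕ.≤-refl , after-idle off , repl-first
      counts : ∀ r → countStarts σ r (3 + t) ≡ released (twoJobs t) r
      counts r rewrite countStarts-idle r | waitForSecond-first | waitForSecond-second = begin
        startsWith r (just 0) + startsWith r (just (suc t))
          ≡⟨ cong (λ n → startsWith r (just 0) + n) (trans (sym (ℕ.+-identityʳ _)) (sym (released-∷ (suc t) [] r))) ⟩
        startsWith r (just 0) + released (suc t ∷ []) r
          ≡⟨ released-∷ 0 (suc t ∷ []) r ⟨
        released (twoJobs t) r ∎
        where open ≡-Reasoning

  late-replenishment-cost : ∀ {σ T} m → Feasible oneJob σ T → (∀ i → i < m → repl σ i ≡ false) →
              suc m ≤ flowSum σ T × 1 ≤ replCount σ T
  late-replenishment-cost {σ} {T} m feasible idle =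
    ℕ.≤-trans (s≤s (ℕ.≤-trans m≤replTime (replTime≤startTime job))) (flowTime≤flowSum job) ,
    replenishment≤replCount (replTime<T job) (replenishes job)
    where
    job : Service σ T 0
    job = served {oneJob} feasible (released-head 0 [])
    m≤replTime : m ≤ replTime job
    m≤replTime = ℕ.≮⇒≥ λ u<m → case trans (sym (replenishes job)) (idle _ u<m) of λ ()

  early-replenishment-cost : ∀ {σ T} t → Feasible (twoJobs t) σ T → repl σ t ≡ true → (∀ i → i < t → repl σ i ≡ false) →
               2 + t ≤ flowSum σ T × 2 ≤ replCount σ T
  early-replenishment-cost {σ} {T} t feasible repl-t idle =
    ℕ.≤-trans (subst (_≤ flowTime first + flowTime second) (ℕ.+-comm (suc t) 1)
                     (ℕ.+-mono-≤ (s≤s (ℕ.≤-trans t≤replTime (replTime≤startTime first)))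
                                 (ℕ.m<n⇒0<n∸m (ℕ.≤-trans (r≤replTime second) (replTime≤startTime second)))))
              (flowTimes≤flowSum (λ ()) first second) ,
    replenishments≤replCount (r≤replTime second) (replTime<T second) repl-t (replenishes second)
    where
    first : Service σ T 0
    first = served {twoJobs t} feasible (released-head 0 (suc t ∷ []))
    second : Service σ T (suc t)
    second = served {twoJobs t} feasible (subst (0 <_) (sym (released-∷ 0 (suc t ∷ []) (suc t)))
                                    (ℕ.≤-trans (released-head (suc t) []) (ℕ.m≤n+m _ _)))
    t≤replTime : t ≤ replTime first
    t≤replTime = ℕ.≮⇒≥ λ u<t → case trans (sym (replenishes first)) (idle _ u<t) of λ ()

  late-ratio : ∀ {D m} → D < m → 3 * D * (1 + 2 * m * 1) < 2 * D * (suc m + 2 * m * 1) + 2 * (1 + 2 * m * 1)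
  late-ratio {D} {m} D<m =
    subst₂ _<_ (sym (lhs D m)) (sym (rhs D m)) (ℕ.+-monoʳ-< (6 * D * m + 2 * D) D<4m+2)
    where
    D<4m+2 : D < 4 * m + 2
    D<4m+2 = ℕ.<-≤-trans D<m (ℕ.≤-trans (ℕ.m≤m+n m (3 * m)) (ℕ.m≤m+n (4 * m) 2))
    lhs : ∀ D m → 3 * D * (1 + 2 * m * 1) ≡ 6 * D * m + 2 * D + D
    lhs = solve-∀
    rhs : ∀ D m → 2 * D * (suc m + 2 * m * 1) + 2 * (1 + 2 * m * 1) ≡ 6 * D * m + 2 * D + (4 * m + 2)
    rhs = solve-∀

  early-ratio : ∀ D {m t} → 8 ≤ m → t < m →
                3 * D * (4 + t + 2 * m * 1) < 2 * D * (2 + t + 2 * m * 2) + 2 * (4 + t + 2 * m * 1)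
  early-ratio D {m} {t} 8≤m t<m = begin-strict
    3 * D * B         ≡⟨ trans (cong (_* B) (ℕ.*-comm 3 D)) (ℕ.*-assoc D 3 B) ⟩
    D * (3 * B)       ≤⟨ ℕ.*-monoʳ-≤ D 3B≤2A ⟩
    D * (2 * A)       ≡⟨ trans (cong (_* A) (ℕ.*-comm 2 D)) (ℕ.*-assoc D 2 A) ⟨
    2 * D * A         <⟨ ℕ.m<m+n (2 * D * A) (s≤s z≤n) ⟩
    2 * D * A + 2 * B ∎
    where
    open ℕ.≤-Reasoning
    A = 2 + t + 2 * m * 2
    B = 4 + t + 2 * m * 1
    t+8≤2m : t + 8 ≤ 2 * m
    t+8≤2m = subst (t + 8 ≤_) (cong (m +_) (sym (ℕ.+-identityʳ m))) (ℕ.+-mono-≤ (ℕ.<⇒≤ t<m) 8≤m)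
    3B : ∀ t m → 4 + 2 * t + 6 * m + (t + 8) ≡ 3 * (4 + t + 2 * m * 1)
    3B = solve-∀
    2A : ∀ t m → 4 + 2 * t + 6 * m + 2 * m ≡ 2 * (2 + t + 2 * m * 2)
    2A = solve-∀
    3B≤2A : 3 * B ≤ 2 * A
    3B≤2A = subst₂ _≤_ (3B t m) (2A t m) (ℕ.+-monoʳ-≤ (4 + 2 * t + 6 * m) t+8≤2m)

  competitive-bound : ∀ {ε} → ℚ.0ℚ ℚ.< ε → ∀ A → Competitive (threeHalves ℚ.- ε) A → ∀ k jobs {F R} →
      (∀ {T} → Feasible jobs (run A (toℚ k) jobs) T →
               F ≤ flowSum (run A (toℚ k) jobs) T × R ≤ replCount (run A (toℚ k) jobs) T) →
      ∀ {σ T F′ R′} → Feasible jobs σ T → flowSum σ T ≡ F′ → replCount σ T ≡ R′ →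
      2 * ℚ.↧ₙ ε * (F + k * R) + 2 * (F′ + k * R′) ≤ 3 * ℚ.↧ₙ ε * (F′ + k * R′)
  competitive-bound {ε} ε>0 A competitive k jobs {F} {R} lower {σ} {T} {F′} {R′} feasible refl refl =
    below-threeHalves-ε ε (ℚ.positive ε>0) (F + k * R) (F′ + k * R′) (begin
      toℚ (F + k * R)                               ≤⟨ toℚ-mono-≤ (ℕ.+-mono-≤ (proj₁ A-lower) (ℕ.*-monoʳ-≤ k (proj₂ A-lower))) ⟩
      toℚ (flowSum σ₀ T₀ + k * replCount σ₀ T₀)     ≡⟨ cost-toℚ k σ₀ T₀ ⟨
      cost (toℚ k) σ₀ T₀                            ≤⟨ proj₂ (proj₂ A-run) σ T feasible ⟩
      (threeHalves ℚ.- ε) ℚ.* cost (toℚ k) σ T      ≡⟨ cong ((threeHalves ℚ.- ε) ℚ.*_) (cost-toℚ k σ T) ⟩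
      (threeHalves ℚ.- ε) ℚ.* toℚ (F′ + k * R′)     ∎)
    where
    open ℚ.≤-Reasoning
    σ₀ = run A (toℚ k) jobs
    A-run = competitive (toℚ k) (toℚ-mono-≤ {0} {k} z≤n) jobs
    T₀ = proj₁ A-run
    A-lower = lower (proj₁ (proj₂ A-run))

  deadline : ℚ.ℚ → ℕ
  deadline ε = ℚ.↧ₙ ε + 8

  replenishmentCost : ℚ.ℚ → ℕ
  replenishmentCost ε = 2 * deadline ε

  module _ {ε} (ε>0 : ℚ.0ℚ ℚ.< ε) (A : OnlineAlgorithm) (competitive : Competitive (threeHalves ℚ.- ε) A) where

    private
      D = ℚ.↧ₙ ε
      m = deadline ε
      k = replenishmentCost ε
      K = toℚ k

    replenishing-late-loses : (∀ i → i < m → repl (run A K oneJob) i ≡ false) → ⊥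
    replenishing-late-loses idle = ℕ.<⇒≱ (late-ratio (ℕ.m<m+n D (s≤s z≤n)))
      (competitive-bound ε>0 A competitive k oneJob (λ feasible → late-replenishment-cost m feasible idle)
                         serveAtOnce-feasible refl refl)

    replenishing-early-loses :
      (∃ λ t → t < m × repl (run A K oneJob) t ≡ true × (∀ i → i < t → repl (run A K oneJob) i ≡ false)) → ⊥
    replenishing-early-loses (t , t<m , repl-t , idle) = ℕ.<⇒≱ (early-ratio D (ℕ.m≤n+m 8 D) t<m)
      (competitive-bound ε>0 A competitive k (twoJobs t)
         (λ feasible → early-replenishment-cost t feasible (trans (sym (same ℕ.≤-refl)) repl-t)
                                           (λ i i<t → trans (sym (same (ℕ.<⇒≤ i<t))) (idle i i<t)))
         (waitForSecond-feasible t) (waitForSecond-flowSum t) (waitForSecond-replCount t))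
      where
      same : ∀ {s} → s ≤ t → repl (run A K oneJob) s ≡ repl (run A K (twoJobs t)) s
      same = repl-causal A K {oneJob} {twoJobs t} oneJob≈twoJobs

open Schedules using (all-false⊎first-true)
open Adversary

open import Data.Rational using (ℚ; _-_; _<_; 0ℚ)
open import Relation.Nullary using (¬_)

theorem14 : (ε : ℚ) → 0ℚ < ε → ¬ (Σ OnlineAlgorithm λ A → Competitive (threeHalves - ε) A)
theorem14 ε ε>0 (A , competitive) =
  [ replenishing-late-loses ε>0 A competitive , replenishing-early-loses ε>0 A competitive ]′
    (all-false⊎first-true (repl (run A (toℚ (replenishmentCost ε)) oneJob)) (deadline ε))
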